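{- Let $q\ge 2$, $k\ge 1$ and $\Delta\ge 1$ be integers, let $t=(q^k-q)^{1/\Delta}$, and let $\mathbf B=(B_{ij})_{i,j\in\{0,1,\dots,q\}}$ be the matrix with $B_{00}=t^2$, $B_{0i}=B_{i0}=t$ for $i\in\{1,\dots,q\}$, $B_{ii}=0$ for $i\in\{1,\dots,q\}$, and $B_{ij}=1$ for distinct $i,j\in\{1,\dots,q\}$. Let $G=(V,E)$ be a $\Delta$-regular graph and let $H_G$ be the hypergraph obtained by replacing each vertex $v\in V$ by $k$ new vertices $v_1,\dots,v_k$ and each edge $(u,v)\in E$ by the hyperedge $\{u_1,\dots,u_k,v_1,\dots,v_k\}$. Then $Z_{\mathbf B}(G)=Z_{col}(H_G)$.
   Context: For a graph $G=(V,E)$, $Z_{\mathbf B}(G)=\sum_{\sigma:V\to\{0,1,\dots,q\}}\prod_{(u,v)\in E}B_{\sigma(u)\sigma(v)}$. For a hypergraph $H$, $Z_{col}(H)$ is the number of proper $q$-colourings of $H$, i.e. maps from its vertex set to $\{1,\dots,q\}$ under which no hyperedge is monochromatic. -}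

module Defs where

open import Level using (Level)
open import Data.Nat as ℕ using (ℕ; zero; suc)
open import Data.Fin using (Fin; zero; suc; combine; _≟_)
open import Data.Product using (_×_; _,_; ∃)
open import Data.Sum using (_⊎_)
open import Data.List using (List; []; _∷_; map; allFin; _++_; foldr)
open import Data.List.Relation.Unary.All using (All)
open import Data.List.Relation.Unary.AllPairs using (AllPairs)
open import Data.Vec.Functional using () renaming (_∷_ to _∷ᶠ_)
open import Relation.Nullary using (¬_; Dec; yes; no)
open import Relation.Nullary.Decidable using (⌊_⌋)
open import Relation.Binary.PropositionalEquality using (_≡_; _≢_)
open import Algebra.Bundles using (CommutativeSemiring)

SameEdge : ∀ {n} → Fin n × Fin n → Fin n × Fin n → Set
SameEdge (u , v) (u' , v') = (u ≡ u' × v ≡ v') ⊎ (u ≡ v' × v ≡ u')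

record Graph : Set where
  field
    n      : ℕ
    edges  : List (Fin n × Fin n)
    loopless : All (λ e → Data.Product.proj₁ e ≢ Data.Product.proj₂ e) edges
    simple   : AllPairs (λ e e' → ¬ SameEdge e e') edges
open Graph public

ind : ∀ {P : Set} → Dec P → ℕ
ind (yes _) = 1
ind (no _)  = 0

degree : (G : Graph) → Fin (n G) → ℕ
degree G v = foldr (λ e acc → ind (Data.Product.proj₁ e ≟ v) ℕ.+ ind (Data.Product.proj₂ e ≟ v) ℕ.+ acc) 0 (edges G)

Regular : ℕ → Graph → Set
Regular Δ G = ∀ v → degree G v ≡ Δ

module _ {c ℓ : Level} (R : CommutativeSemiring c ℓ) where
  open CommutativeSemiring R

  sumList : ∀ {A : Set} → (A → Carrier) → List A → Carrier
  sumList f = foldr (λ a acc → f a + acc) 0#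

  prodList : ∀ {A : Set} → (A → Carrier) → List A → Carrier
  prodList f = foldr (λ a acc → f a * acc) 1#

  sumMaps : (m p : ℕ) → ((Fin m → Fin p) → Carrier) → Carrier
  sumMaps zero    p f = f (λ ())
  sumMaps (suc m) p f = sumList (λ a → sumMaps m p (λ g → f (a ∷ᶠ g))) (allFin p)

  pow : Carrier → ℕ → Carrier
  pow x zero    = 1#
  pow x (suc k) = x * pow x k

  fromℕ : ℕ → Carrier
  fromℕ zero    = 0#
  fromℕ (suc k) = 1# + fromℕ k

  B : (q : ℕ) → Carrier → Fin (suc q) → Fin (suc q) → Carrier
  B q t zero    zero    = t * t
  B q t zero    (suc j) = t
  B q t (suc i) zero    = t
  B q t (suc i) (suc j) with i ≟ j
  ... | yes _ = 0#
  ... | no  _ = 1#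

  ZB : (q : ℕ) → Carrier → Graph → Carrier
  ZB q t G = sumMaps (n G) (suc q)
    (λ σ → prodList (λ e → B q t (σ (Data.Product.proj₁ e)) (σ (Data.Product.proj₂ e))) (edges G))

record Hypergraph : Set where
  field
    m     : ℕ
    hedges : List (List (Fin m))
open Hypergraph public

Monochromatic : ∀ {m q} → (Fin m → Fin q) → List (Fin m) → Set
Monochromatic {q = q} c e = ∃ λ (a : Fin q) → All (λ x → c x ≡ a) e

Proper : ∀ {m q} → (Fin m → Fin q) → List (List (Fin m)) → Set
Proper c es = All (λ e → ¬ Monochromatic c e) es

open import Data.List.Relation.Unary.All using (all?)
open import Data.Fin.Properties using (any?)
open import Relation.Nullary.Decidable using (¬?)

monochromatic? : ∀ {m q} (c : Fin m → Fin q) (e : List (Fin m)) → Dec (Monochromatic c e)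
monochromatic? c e = any? (λ a → all? (λ x → c x ≟ a) e)

proper? : ∀ {m q} (c : Fin m → Fin q) (es : List (List (Fin m))) → Dec (Proper c es)
proper? c es = all? (λ e → ¬? (monochromatic? c e)) es

open import Data.Nat.Properties using (+-*-commutativeSemiring)

Zcol : (q : ℕ) → Hypergraph → ℕ
Zcol q H = sumMaps +-*-commutativeSemiring (m H) q (λ c → ind (proper? c (hedges H)))

-- H_G: vertex v_i (v ∈ V, i ∈ {1..k}) is  combine v i : Fin (n * k);
-- edge (u,v) becomes {u_1..u_k, v_1..v_k}.
HG : (k : ℕ) → Graph → Hypergraph
HG k G = record
  { m = n G ℕ.* k
  ; hedges = map (λ e → map (combine (Data.Product.proj₁ e)) (allFin k)
                        ++ map (combine (Data.Product.proj₂ e)) (allFin k)) (edges G)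
  }

-- Put T 0 = t, T i = 1, and A x y = 0 when x and y are the same non-zero colour, A x y = 1 otherwise, so that
-- B x y = T x · T y · A x y. As G is Δ-regular, the factors T collect into ∏_v T(σ v)^Δ, and T(a)^Δ = w a
-- with w 0 = q^k − q and w i = 1; so Z_B(G) = Σ_σ ∏_v w(σ v) · ∏_{uv ∈ E} A(σ u, σ v).
-- A colouring of H_G is a choice of a block c_v ∈ [q]^k for every vertex v. Record each block by its block
-- colour: i if c_v is constant i, and 0 if it is not constant. Exactly w a blocks have block colour a, and the
-- hyperedge of uv is monochromatic iff the blocks of u and v are constant of the same colour, i.e. iff A
-- vanishes at their block colours.
-- Grouping the proper colourings of H_G by their block colours therefore gives the same weighted sum.
module Submission where

open import Defs
open import Level using (Level; _⊔_; 0ℓ)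
open import Data.Nat as ℕ using (ℕ; zero; suc; _≤_; _^_; _∸_)
open import Data.Nat.Properties as ℕ using (+-*-commutativeSemiring; +-0-monoid; m+n∸n≡m)
open import Data.Fin using (Fin; zero; suc; splitAt; combine; _≟_)
open import Data.Fin.Properties using (0≢1+n; suc-injective; all?; remQuot-combine)
open import Data.Sum using (inj₁; inj₂)
open import Data.Product using (_×_; _,_; proj₁; proj₂; uncurry; swap; ∃)
open import Data.Unit using (tt)
open import Data.List as List using (List; []; _∷_; tabulate)
open import Data.List.Properties using (foldr-map)
open import Data.List.Relation.Unary.All as All using (All)
import Data.List.Relation.Unary.All.Properties as AllP
open import Data.Vec.Functional using (Vector; _++_; concat) renaming (_∷_ to _∷ᶠ_)
open import Data.Vec.Functional.Properties using (∷-cong; ++-cong)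
open import Function using (_∘_; flip)
open import Relation.Binary.PropositionalEquality as ≡ using (_≡_; _≗_)
open import Relation.Nullary using (¬_; Dec; yes; no)
open import Relation.Nullary.Negation using (contradiction)
open import Relation.Nullary.Decidable using (_×-dec_; ¬?)
open import Algebra.Bundles using (Monoid; CommutativeSemiring)

ℕ-semiring : CommutativeSemiring 0ℓ 0ℓ
ℕ-semiring = +-*-commutativeSemiring

ind-cong : ∀ {P Q : Set} (p? : Dec P) (q? : Dec Q) → (P → Q) → (Q → P) → ind p? ≡ ind q?
ind-cong (yes _) (yes _) _   _   = ≡.refl
ind-cong (yes p) (no ¬q) p→q _   = contradiction (p→q p) ¬q
ind-cong (no ¬p) (yes q) _   q→p = contradiction (q→p q) ¬p
ind-cong (no _)  (no _)  _   _   = ≡.refl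

ind-suc≟suc : ∀ {n} (u v : Fin n) → ind (suc u ≟ suc v) ≡ ind (u ≟ v)
ind-suc≟suc u v = ind-cong _ _ suc-injective (≡.cong suc)

ind-×-dec : ∀ {P Q : Set} (p? : Dec P) (q? : Dec Q) → ind (p? ×-dec q?) ≡ ind p? ℕ.* ind q?
ind-×-dec (yes _) (yes _) = ≡.refl
ind-×-dec (yes _) (no _)  = ≡.refl
ind-×-dec (no _)  _       = ≡.refl

0≡ind¬? : ∀ {P : Set} (p? : Dec P) → P → 0 ≡ ind (¬? p?)
0≡ind¬? (yes _) _ = ≡.refl
0≡ind¬? (no ¬p) p = contradiction p ¬p

1≡ind¬? : ∀ {P : Set} (p? : Dec P) → ¬ P → 1 ≡ ind (¬? p?)
1≡ind¬? (yes p) ¬p = contradiction p ¬p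
1≡ind¬? (no _)  _  = ≡.refl

module _ {a ℓ} (M : Monoid a ℓ) where
  open Monoid M
  open import Algebra.Properties.Monoid.Sum M using (sum; sum-cong-≋; sum-replicate-zero)
  open import Algebra.Properties.Monoid.Mult M using (×-homo-1) renaming (_×_ to _·_)

  sum-δ : ∀ {n} (u : Fin n) (g : Fin n → Carrier) → sum (λ v → ind (u ≟ v) · g v) ≈ g u
  sum-δ {suc n} zero    g = trans (∙-cong (×-homo-1 (g zero)) (sum-replicate-zero n)) (identityʳ _)
  sum-δ {suc n} (suc u) g = trans (identityˡ _) (trans
    (sum-cong-≋ (λ v → reflexive (≡.cong (_· g (suc v)) (ind-suc≟suc u v))))
    (sum-δ u (λ v → g (suc v))))

∷-++ : ∀ {A : Set} {m n} (a : A) (g : Vector A m) (h : Vector A n) → (a ∷ᶠ (g ++ h)) ≗ ((a ∷ᶠ g) ++ h)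
∷-++ a g h zero = ≡.refl
∷-++ {m = m} a g h (suc i) with splitAt m i
... | inj₁ _ = ≡.refl
... | inj₂ _ = ≡.refl

concat-∷ : ∀ {A : Set} {m n} (g : Vector A m) (C : Vector (Vector A m) n) →
           concat (g ∷ᶠ C) ≗ (g ++ concat C)
concat-∷ {m = m} g C i with splitAt m i
... | inj₁ _ = ≡.refl
... | inj₂ _ = ≡.refl

concat-combine : ∀ {A : Set} {m n} (C : Vector (Vector A m) n) u j → concat C (combine u j) ≡ C u j
concat-combine C u j = ≡.cong (uncurry (flip C)) (≡.cong swap (remQuot-combine u j))

sumMapsWith : ∀ {a} {X : Set a} {A : Set} (n : ℕ) → ((A → X) → X) → ((Fin n → A) → X) → X
sumMapsWith zero    S f = f (λ ())
sumMapsWith (suc n) S f = S (λ a → sumMapsWith n S (λ g → f (a ∷ᶠ g)))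

module Summation {c ℓ} (R : CommutativeSemiring c ℓ) where
  open CommutativeSemiring R hiding (zero)
  open import Algebra.Properties.Semiring.Sum semiring public using (sum)
  open import Algebra.Properties.Semiring.Sum semiring
    using (sum-cong-≋; ∑-distrib-+; sum-replicate-zero; *-distribˡ-sum)
  open import Algebra.Properties.CommutativeMonoid.Sum *-commutativeMonoid public using () renaming (sum to ∏)
  open import Algebra.Properties.CommutativeSemigroup *-commutativeSemigroup using (x∙yz≈y∙xz)
  open import Relation.Binary.Reasoning.Setoid setoid

  record IsSummation {A : Set} (S : (A → Carrier) → Carrier) : Set (c ⊔ ℓ) where
    field
      cong   : ∀ {f g} → (∀ a → f a ≈ g a) → S f ≈ S g
      +-homo : ∀ f g → S (λ a → f a + g a) ≈ S f + S g
      0-homo : S (λ _ → 0#) ≈ 0#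
      *-homo : ∀ x f → S (λ a → x * f a) ≈ x * S f
  open IsSummation public

  Extensional : ∀ {A : Set} {n} → ((Fin n → A) → Carrier) → Set ℓ
  Extensional f = ∀ {g g'} → g ≗ g' → f g ≈ f g'

  isSummation-sum : ∀ {n} → IsSummation (sum {n})
  isSummation-sum {n} = record
    { cong   = sum-cong-≋
    ; +-homo = ∑-distrib-+
    ; 0-homo = sum-replicate-zero n
    ; *-homo = λ x f → sym (*-distribˡ-sum x f)
    }

  reweight : ∀ {A : Set} → (A → Carrier) → ((A → Carrier) → Carrier) → (A → Carrier) → Carrier
  reweight w S h = S (λ a → w a * h a)

  isSummation-reweight : ∀ {A : Set} {S : (A → Carrier) → Carrier} (w : A → Carrier) →
                         IsSummation S → IsSummation (reweight w S)
  isSummation-reweight w iS = record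
    { cong   = λ e → cong iS (λ a → *-congˡ (e a))
    ; +-homo = λ f g → trans (cong iS (λ a → distribˡ (w a) (f a) (g a))) (+-homo iS _ _)
    ; 0-homo = trans (cong iS (λ a → zeroʳ (w a))) (0-homo iS)
    ; *-homo = λ x f → trans (cong iS (λ a → x∙yz≈y∙xz (w a) x (f a))) (*-homo iS x _)
    }

  sumMapsWith-cong : ∀ {A : Set} {S : (A → Carrier) → Carrier} → IsSummation S →
                     ∀ n {f f' : (Fin n → A) → Carrier} → (∀ g → f g ≈ f' g) →
                     sumMapsWith n S f ≈ sumMapsWith n S f'
  sumMapsWith-cong iS zero    e = e _
  sumMapsWith-cong iS (suc n) e = cong iS (λ a → sumMapsWith-cong iS n (λ g → e (a ∷ᶠ g)))

  isSummation-sumMapsWith : ∀ {A : Set} {S : (A → Carrier) → Carrier} → IsSummation S →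
                            ∀ n → IsSummation (sumMapsWith n S)
  isSummation-sumMapsWith {S = S} iS n = record
    { cong = sumMapsWith-cong iS n ; +-homo = +-homo′ n ; 0-homo = 0-homo′ n ; *-homo = *-homo′ n }
    where
    +-homo′ : ∀ n f g → sumMapsWith n S (λ a → f a + g a) ≈ sumMapsWith n S f + sumMapsWith n S g
    +-homo′ zero    f g = refl
    +-homo′ (suc n) f g = trans (cong iS (λ a → +-homo′ n _ _)) (+-homo iS _ _)
    0-homo′ : ∀ n → sumMapsWith n S (λ _ → 0#) ≈ 0#
    0-homo′ zero    = refl
    0-homo′ (suc n) = trans (cong iS (λ a → 0-homo′ n)) (0-homo iS)
    *-homo′ : ∀ n x f → sumMapsWith n S (λ a → x * f a) ≈ x * sumMapsWith n S f
    *-homo′ zero    x f = refl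
    *-homo′ (suc n) x f = trans (cong iS (λ a → *-homo′ n x _)) (*-homo iS _ _)

  module _ {A : Set} {S : (A → Carrier) → Carrier} (iS : IsSummation S) where

    summation-sum-comm : ∀ {m} (F : A → Fin m → Carrier) →
                         S (λ a → sum (F a)) ≈ sum (λ i → S (λ a → F a i))
    summation-sum-comm {zero}  F = 0-homo iS
    summation-sum-comm {suc m} F = trans (+-homo iS _ _) (+-congˡ (summation-sum-comm (λ a i → F a (suc i))))

    sumMapsWith-++ : ∀ m n (f : (Fin (m ℕ.+ n) → A) → Carrier) → Extensional f →
                     sumMapsWith (m ℕ.+ n) S f ≈ sumMapsWith m S (λ g → sumMapsWith n S (λ h → f (g ++ h)))
    sumMapsWith-++ zero    n f ext = sumMapsWith-cong iS n (λ h → ext (λ _ → ≡.refl))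
    sumMapsWith-++ (suc m) n f ext = cong iS λ a → begin
      sumMapsWith (m ℕ.+ n) S (λ g → f (a ∷ᶠ g))
        ≈⟨ sumMapsWith-++ m n (λ g → f (a ∷ᶠ g)) (λ e → ext (∷-cong ≡.refl e)) ⟩
      sumMapsWith m S (λ g → sumMapsWith n S (λ h → f (a ∷ᶠ (g ++ h))))
        ≈⟨ sumMapsWith-cong iS m (λ g → sumMapsWith-cong iS n (λ h → ext (∷-++ a g h))) ⟩
      sumMapsWith m S (λ g → sumMapsWith n S (λ h → f ((a ∷ᶠ g) ++ h))) ∎

    sumMapsWith-concat : ∀ n k (f : (Fin (n ℕ.* k) → A) → Carrier) → Extensional f →
                         sumMapsWith (n ℕ.* k) S f ≈ sumMapsWith n (sumMapsWith k S) (λ C → f (concat C))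
    sumMapsWith-concat zero    k f ext = ext (λ ())
    sumMapsWith-concat (suc n) k f ext = begin
      sumMapsWith (k ℕ.+ n ℕ.* k) S f
        ≈⟨ sumMapsWith-++ k (n ℕ.* k) f ext ⟩
      sumMapsWith k S (λ g → sumMapsWith (n ℕ.* k) S (λ h → f (g ++ h)))
        ≈⟨ sumMapsWith-cong iS k (λ g →
             sumMapsWith-concat n k (λ h → f (g ++ h)) (λ e → ext (++-cong g g (λ _ → ≡.refl) e))) ⟩
      sumMapsWith k S (λ g → sumMapsWith n (sumMapsWith k S) (λ C → f (g ++ concat C)))
        ≈⟨ sumMapsWith-cong iS k (λ g → sumMapsWith-cong (isSummation-sumMapsWith iS k) n (λ C →
             ext (λ i → ≡.sym (concat-∷ g C i)))) ⟩
      sumMapsWith (suc n) (sumMapsWith k S) (λ C → f (concat C)) ∎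

    sumMapsWith-∏ : ∀ k (g : A → Carrier) →
                    sumMapsWith k S (λ c → ∏ (λ j → g (c j))) ≈ pow R (S g) k
    sumMapsWith-∏ zero    g = refl
    sumMapsWith-∏ (suc k) g = begin
      S (λ a → sumMapsWith k S (λ c → g a * ∏ (λ j → g (c j))))
        ≈⟨ cong iS (λ a → *-homo (isSummation-sumMapsWith iS k) (g a) _) ⟩
      S (λ a → g a * sumMapsWith k S (λ c → ∏ (λ j → g (c j))))
        ≈⟨ cong iS (λ a → trans (*-congˡ (sumMapsWith-∏ k g)) (*-comm (g a) _)) ⟩
      S (λ a → pow R (S g) k * g a)
        ≈⟨ *-homo iS (pow R (S g) k) g ⟩
      pow R (S g) k * S g
        ≈⟨ *-comm _ _ ⟩
      S g * pow R (S g) k ∎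

    sumMapsWith-reweight : ∀ n (w : A → Carrier) (F : (Fin n → A) → Carrier) →
                           sumMapsWith n S (λ σ → ∏ (λ v → w (σ v)) * F σ) ≈
                           sumMapsWith n (reweight w S) F
    sumMapsWith-reweight zero    w F = *-identityˡ _
    sumMapsWith-reweight (suc n) w F = cong iS λ a → begin
      sumMapsWith n S (λ σ → (w a * ∏ (λ v → w (σ v))) * F (a ∷ᶠ σ))
        ≈⟨ sumMapsWith-cong iS n (λ σ → *-assoc _ _ _) ⟩
      sumMapsWith n S (λ σ → w a * (∏ (λ v → w (σ v)) * F (a ∷ᶠ σ)))
        ≈⟨ *-homo (isSummation-sumMapsWith iS n) _ _ ⟩
      w a * sumMapsWith n S (λ σ → ∏ (λ v → w (σ v)) * F (a ∷ᶠ σ))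
        ≈⟨ *-congˡ (sumMapsWith-reweight n w (λ σ → F (a ∷ᶠ σ))) ⟩
      w a * sumMapsWith n (reweight w S) (λ σ → F (a ∷ᶠ σ)) ∎

    sumMapsWith-pushforward : ∀ {B : Set} {S' : (B → Carrier) → Carrier} (φ : A → B) →
                              (∀ h → S (λ a → h (φ a)) ≈ S' h) →
                              ∀ n (F : (Fin n → B) → Carrier) → Extensional F →
                              sumMapsWith n S (λ C → F (λ v → φ (C v))) ≈ sumMapsWith n S' F
    sumMapsWith-pushforward φ push zero    F ext = ext (λ ())
    sumMapsWith-pushforward φ push (suc n) F ext = trans
      (cong iS λ a → trans
        (sumMapsWith-cong iS n (λ C → ext (∷-cong ≡.refl (λ _ → ≡.refl))))
        (sumMapsWith-pushforward φ push n (λ σ → F (φ a ∷ᶠ σ)) (λ e → ext (∷-cong ≡.refl e))))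
      (push (λ b → sumMapsWith n _ (λ σ → F (b ∷ᶠ σ))))

  sumMapsWith-natural : ∀ {a} {X : Set a} {A : Set} (φ : X → Carrier) {S₀ : (A → X) → X}
                        {S : (A → Carrier) → Carrier} → IsSummation S →
                        (∀ h → φ (S₀ h) ≈ S (λ a → φ (h a))) →
                        ∀ n f → φ (sumMapsWith n S₀ f) ≈ sumMapsWith n S (λ σ → φ (f σ))
  sumMapsWith-natural φ iS natural zero    f = refl
  sumMapsWith-natural φ iS natural (suc n) f =
    trans (natural _) (cong iS (λ a → sumMapsWith-natural φ iS natural n _))

  sumList-tabulate : ∀ {A : Set} {n} (f : A → Carrier) (h : Fin n → A) →
                     sumList R f (tabulate h) ≈ sum (λ i → f (h i))
  sumList-tabulate {n = zero}  f h = refl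
  sumList-tabulate {n = suc n} f h = +-congˡ (sumList-tabulate f (λ i → h (suc i)))

  sumMaps≈sumMapsWith-sum : ∀ m p (f : (Fin m → Fin p) → Carrier) → sumMaps R m p f ≈ sumMapsWith m sum f
  sumMaps≈sumMapsWith-sum zero    p f = refl
  sumMaps≈sumMapsWith-sum (suc m) p f =
    trans (sumList-tabulate (λ a → sumMaps R m p (λ g → f (a ∷ᶠ g))) (λ i → i))
          (sum-cong-≋ (λ a → sumMaps≈sumMapsWith-sum m p (λ g → f (a ∷ᶠ g))))

degreeIn : ∀ {n} → List (Fin n × Fin n) → Fin n → ℕ
degreeIn L v = List.foldr (λ e acc → ind (proj₁ e ≟ v) ℕ.+ ind (proj₂ e ≟ v) ℕ.+ acc) 0 L

module Products {c ℓ} (R : CommutativeSemiring c ℓ) where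
  open CommutativeSemiring R hiding (zero)
  open Summation R using (∏; sum; reweight; cong; isSummation-sum)
  open import Algebra.Properties.CommutativeMonoid.Sum *-commutativeMonoid public using ()
    renaming (sum-cong-≋ to ∏-cong; ∑-distrib-+ to ∏-distrib-*; sum-replicate-zero to ∏-const-1#)
  open import Algebra.Properties.Monoid.Mult *-monoid using () renaming (_×_ to _×*_; ×-homo-+ to ×*-homo-+)
  open import Algebra.Properties.Semiring.Mult semiring using (×-homo-+; ×1-homo-*) renaming (_×_ to _×+_)
  open import Algebra.Properties.CommutativeSemigroup *-commutativeSemigroup using (interchange)
  open import Relation.Binary.Reasoning.Setoid setoid

  pow≡× : ∀ x n → pow R x n ≡ n ×* x
  pow≡× x zero    = ≡.refl
  pow≡× x (suc n) = ≡.cong (x *_) (pow≡× x n)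

  pow-homo-+ : ∀ x m n → pow R x (m ℕ.+ n) ≈ pow R x m * pow R x n
  pow-homo-+ x m n = begin
    pow R x (m ℕ.+ n)     ≡⟨ pow≡× x (m ℕ.+ n) ⟩
    (m ℕ.+ n) ×* x        ≈⟨ ×*-homo-+ x m n ⟩
    m ×* x * n ×* x       ≡⟨ ≡.cong₂ _*_ (pow≡× x m) (pow≡× x n) ⟨
    pow R x m * pow R x n ∎

  pow-1# : ∀ n → pow R 1# n ≈ 1#
  pow-1# zero    = refl
  pow-1# (suc n) = trans (*-identityˡ _) (pow-1# n)

  ∏-pow-δ : ∀ {n} (u : Fin n) (g : Fin n → Carrier) → ∏ (λ v → pow R (g v) (ind (u ≟ v))) ≈ g u
  ∏-pow-δ u g = trans (∏-cong (λ v → reflexive (pow≡× (g v) (ind (u ≟ v))))) (sum-δ *-monoid u g)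

  fromℕ≡× : ∀ n → fromℕ R n ≡ n ×+ 1#
  fromℕ≡× zero    = ≡.refl
  fromℕ≡× (suc n) = ≡.cong (1# +_) (fromℕ≡× n)

  fromℕ-1 : fromℕ R 1 ≈ 1#
  fromℕ-1 = +-identityʳ 1#

  x≈x*fromℕ-1 : ∀ x → x ≈ x * fromℕ R 1
  x≈x*fromℕ-1 x = sym (trans (*-congˡ fromℕ-1) (*-identityʳ x))

  fromℕ-homo-+ : ∀ m n → fromℕ R (m ℕ.+ n) ≈ fromℕ R m + fromℕ R n
  fromℕ-homo-+ m n = begin
    fromℕ R (m ℕ.+ n)     ≡⟨ fromℕ≡× (m ℕ.+ n) ⟩
    (m ℕ.+ n) ×+ 1#       ≈⟨ ×-homo-+ 1# m n ⟩
    m ×+ 1# + n ×+ 1#     ≡⟨ ≡.cong₂ _+_ (fromℕ≡× m) (fromℕ≡× n) ⟨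
    fromℕ R m + fromℕ R n ∎

  fromℕ-homo-* : ∀ m n → fromℕ R (m ℕ.* n) ≈ fromℕ R m * fromℕ R n
  fromℕ-homo-* m n = begin
    fromℕ R (m ℕ.* n)     ≡⟨ fromℕ≡× (m ℕ.* n) ⟩
    (m ℕ.* n) ×+ 1#       ≈⟨ ×1-homo-* m n ⟩
    m ×+ 1# * n ×+ 1#     ≡⟨ ≡.cong₂ _*_ (fromℕ≡× m) (fromℕ≡× n) ⟨
    fromℕ R m * fromℕ R n ∎

  fromℕ-sum : ∀ {n} (f : Fin n → ℕ) →
              fromℕ R (Summation.sum ℕ-semiring f) ≈ sum (λ i → fromℕ R (f i))
  fromℕ-sum {zero}  f = refl
  fromℕ-sum {suc n} f = trans (fromℕ-homo-+ (f zero) _) (+-congˡ (fromℕ-sum (λ i → f (suc i))))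

  fromℕ-reweight : ∀ {n} (w h : Fin n → ℕ) →
                   fromℕ R (Summation.reweight ℕ-semiring w (Summation.sum ℕ-semiring) h) ≈
                   reweight (λ a → fromℕ R (w a)) sum (λ a → fromℕ R (h a))
  fromℕ-reweight w h =
    trans (fromℕ-sum (λ a → w a ℕ.* h a)) (cong isSummation-sum (λ a → fromℕ-homo-* (w a) (h a)))

  prodList-cong : ∀ {A : Set} (L : List A) {f g : A → Carrier} →
                  (∀ a → f a ≈ g a) → prodList R f L ≈ prodList R g L
  prodList-cong []      e = refl
  prodList-cong (x ∷ L) e = *-cong (e x) (prodList-cong L e)

  prodList-distrib-* : ∀ {A : Set} (L : List A) (f g : A → Carrier) →
                       prodList R (λ a → f a * g a) L ≈ prodList R f L * prodList R g L
  prodList-distrib-* []      f g = sym (*-identityˡ 1#)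
  prodList-distrib-* (x ∷ L) f g = trans (*-congˡ (prodList-distrib-* L f g)) (interchange _ _ _ _)

  fromℕ-prodList : ∀ {A : Set} (f : A → ℕ) (L : List A) →
                   fromℕ R (prodList ℕ-semiring f L) ≈ prodList R (λ a → fromℕ R (f a)) L
  fromℕ-prodList f []      = fromℕ-1
  fromℕ-prodList f (x ∷ L) = trans (fromℕ-homo-* (f x) _) (*-congˡ (fromℕ-prodList f L))

  prodList-endpoints≈∏-pow-degree : ∀ {n} (L : List (Fin n × Fin n)) (g : Fin n → Carrier) →
    prodList R (λ e → g (proj₁ e) * g (proj₂ e)) L ≈ ∏ (λ v → pow R (g v) (degreeIn L v))
  prodList-endpoints≈∏-pow-degree {n} [] g = sym (∏-const-1# n)
  prodList-endpoints≈∏-pow-degree {n} ((u , w) ∷ L) g = sym (begin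
    ∏ (λ v → pow R (g v) (degreeIn ((u , w) ∷ L) v))
      ≈⟨ ∏-cong (λ v → trans (pow-homo-+ (g v) (ind (u ≟ v) ℕ.+ ind (w ≟ v)) (degreeIn L v))
                              (*-congʳ (pow-homo-+ (g v) (ind (u ≟ v)) (ind (w ≟ v))))) ⟩
    ∏ (λ v → (atᵤ v * atw v) * rest v)
      ≈⟨ trans (∏-distrib-* (λ v → atᵤ v * atw v) rest) (*-congʳ (∏-distrib-* atᵤ atw)) ⟩
    (∏ atᵤ * ∏ atw) * ∏ rest
      ≈⟨ *-cong (*-cong (∏-pow-δ u g) (∏-pow-δ w g)) (sym (prodList-endpoints≈∏-pow-degree L g)) ⟩
    (g u * g w) * prodList R (λ e → g (proj₁ e) * g (proj₂ e)) L ∎)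
    where
    atᵤ atw rest : Fin n → Carrier
    atᵤ v  = pow R (g v) (ind (u ≟ v))
    atw v  = pow R (g v) (ind (w ≟ v))
    rest v = pow R (g v) (degreeIn L v)

module _ where
  open Summation ℕ-semiring

  ind-∀ : ∀ {n} {P : Fin n → Set} (P? : ∀ i → Dec (P i)) → ind (all? P?) ≡ ∏ (λ i → ind (P? i))
  ind-∀ {zero}  P? = ind-cong (all? P?) (yes tt) _ (λ _ ())
  ind-∀ {suc n} P? = begin
    ind (all? P?)
      ≡⟨ ind-cong (all? P?) (P? zero ×-dec all? (P? ∘ suc))
                  (λ p → p zero , p ∘ suc) (λ { (p₀ , p) zero → p₀ ; (p₀ , p) (suc i) → p i }) ⟩
    ind (P? zero ×-dec all? (P? ∘ suc))
      ≡⟨ ind-×-dec (P? zero) _ ⟩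
    ind (P? zero) ℕ.* ind (all? (P? ∘ suc))
      ≡⟨ ≡.cong (ind (P? zero) ℕ.*_) (ind-∀ (P? ∘ suc)) ⟩
    ∏ (λ i → ind (P? i)) ∎
    where open ≡.≡-Reasoning

  ind-All : ∀ {A : Set} {P : A → Set} (P? : ∀ x → Dec (P x)) (L : List A) →
            ind (All.all? P? L) ≡ prodList ℕ-semiring (λ x → ind (P? x)) L
  ind-All P? []      = ≡.refl
  ind-All P? (x ∷ L) = ≡.trans
    (ind-cong (All.all? P? (x ∷ L)) (P? x ×-dec All.all? P? L) All.uncons (uncurry All._∷_))
    (≡.trans (ind-×-dec (P? x) _) (≡.cong (ind (P? x) ℕ.*_) (ind-All P? L)))

  sum-const : ∀ n x → sum {n} (λ _ → x) ≡ n ℕ.* x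
  sum-const zero    x = ≡.refl
  sum-const (suc n) x = ≡.cong (x ℕ.+_) (sum-const n x)

  sum-ind*-δ : ∀ {n} (u : Fin n) (h : Fin n → ℕ) → sum (λ v → ind (u ≟ v) ℕ.* h v) ≡ h u
  sum-ind*-δ u h = ≡.trans (cong isSummation-sum (λ v → ind*≡ind· (u ≟ v) (h v))) (sum-δ +-0-monoid u h)
    where
    open import Algebra.Properties.Monoid.Mult +-0-monoid using () renaming (_×_ to _·_)
    ind*≡ind· : ∀ {P : Set} (p? : Dec P) x → ind p? ℕ.* x ≡ ind p? · x
    ind*≡ind· (yes _) x = ≡.refl
    ind*≡ind· (no _)  x = ≡.refl

  sum-ind-δ : ∀ {n} (u : Fin n) → sum (λ v → ind (u ≟ v)) ≡ 1
  sum-ind-δ u = ≡.trans (cong isSummation-sum (λ v → ≡.sym (ℕ.*-identityʳ (ind (u ≟ v)))))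
                        (sum-ind*-δ u (λ _ → 1))

  summation-fibres : ∀ {A : Set} {S : (A → ℕ) → ℕ} → IsSummation S →
                     ∀ {m} (φ : A → Fin m) (h : Fin m → ℕ) →
                     S (λ x → h (φ x)) ≡ sum (λ a → S (λ x → ind (φ x ≟ a)) ℕ.* h a)
  summation-fibres {A} {S} iS φ h = begin
    S (λ x → h (φ x))
      ≡⟨ cong iS (λ x → ≡.sym (sum-ind*-δ (φ x) h)) ⟩
    S (λ x → sum (λ a → ind (φ x ≟ a) ℕ.* h a))
      ≡⟨ summation-sum-comm iS (λ x a → ind (φ x ≟ a) ℕ.* h a) ⟩
    sum (λ a → S (λ x → ind (φ x ≟ a) ℕ.* h a))
      ≡⟨ cong isSummation-sum (λ a → S-*ʳ (h a)) ⟩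
    sum (λ a → S (λ x → ind (φ x ≟ a)) ℕ.* h a) ∎
    where
    open ≡.≡-Reasoning
    S-*ʳ : ∀ {f : A → ℕ} y → S (λ x → f x ℕ.* y) ≡ S f ℕ.* y
    S-*ʳ {f} y = ≡.trans (cong iS (λ x → ℕ.*-comm (f x) y)) (≡.trans (*-homo iS y f) (ℕ.*-comm y (S f)))

module BlockColours (q k : ℕ) where
  open Summation ℕ-semiring
  open Products ℕ-semiring using (pow-1#)
  open ≡.≡-Reasoning

  -- Blocks have suc k cells: the paper's k is suc k here.
  Block : Set
  Block = Fin (suc k) → Fin q

  -- zero stands for a non-constant block, suc i for the block constantly coloured i.
  blockColour : Block → Fin (suc q)
  blockColour c with all? (λ j → c j ≟ c zero)
  ... | yes _ = suc (c zero)
  ... | no  _ = zero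

  blockColour≡suc⇒constant : ∀ c {i} → blockColour c ≡ suc i → ∀ j → c j ≡ i
  blockColour≡suc⇒constant c eq j with all? (λ j → c j ≟ c zero)
  ... | yes constant = ≡.trans (constant j) (suc-injective eq)

  constant⇒blockColour≡suc : ∀ c {i} → (∀ j → c j ≡ i) → blockColour c ≡ suc i
  constant⇒blockColour≡suc c constant with all? (λ j → c j ≟ c zero)
  ... | yes _        = ≡.cong suc (constant zero)
  ... | no ¬constant = contradiction (λ j → ≡.trans (constant j) (≡.sym (constant zero))) ¬constant

  blockWeight : Fin (suc q) → ℕ
  blockWeight zero    = q ^ suc k ∸ q
  blockWeight (suc _) = 1

  sumBlocks : (Block → ℕ) → ℕ
  sumBlocks = sumMapsWith (suc k) sum

  sumBlockColours : (Fin (suc q) → ℕ) → ℕ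
  sumBlockColours = reweight blockWeight sum

  isSummation-sumBlocks : IsSummation sumBlocks
  isSummation-sumBlocks = isSummation-sumMapsWith isSummation-sum (suc k)

  sumMapsWith-sum-1 : ∀ n → sumMapsWith n (sum {q}) (λ _ → 1) ≡ q ^ n
  sumMapsWith-sum-1 zero    = ≡.refl
  sumMapsWith-sum-1 (suc n) =
    ≡.trans (cong (isSummation-sum {q}) (λ _ → sumMapsWith-sum-1 n)) (sum-const q (q ^ n))

  blockCount : Fin (suc q) → ℕ
  blockCount a = sumBlocks (λ c → ind (blockColour c ≟ a))

  blockCount-suc : ∀ i → blockCount (suc i) ≡ 1
  blockCount-suc i = begin
    sumBlocks (λ c → ind (blockColour c ≟ suc i))
      ≡⟨ cong isSummation-sumBlocks (λ c → ≡.trans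
           (ind-cong (blockColour c ≟ suc i) (all? (λ j → c j ≟ i))
                     (blockColour≡suc⇒constant c) (constant⇒blockColour≡suc c))
           (ind-∀ (λ j → c j ≟ i))) ⟩
    sumBlocks (λ c → ∏ (λ j → ind (c j ≟ i)))
      ≡⟨ sumMapsWith-∏ isSummation-sum (suc k) (λ x → ind (x ≟ i)) ⟩
    pow ℕ-semiring (sum (λ x → ind (x ≟ i))) (suc k)
      ≡⟨ ≡.cong (λ s → pow ℕ-semiring s (suc k)) (≡.trans
           (cong (isSummation-sum {q}) (λ x → ind-cong (x ≟ i) (i ≟ x) ≡.sym ≡.sym)) (sum-ind-δ i)) ⟩
    pow ℕ-semiring 1 (suc k)
      ≡⟨ pow-1# (suc k) ⟩
    1 ∎

  sum-blockCount : sum blockCount ≡ q ^ suc k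
  sum-blockCount = begin
    sum blockCount
      ≡⟨ summation-sum-comm isSummation-sumBlocks (λ c a → ind (blockColour c ≟ a)) ⟨
    sumBlocks (λ c → sum (λ a → ind (blockColour c ≟ a)))
      ≡⟨ cong isSummation-sumBlocks (λ c → sum-ind-δ (blockColour c)) ⟩
    sumBlocks (λ _ → 1)
      ≡⟨ sumMapsWith-sum-1 (suc k) ⟩
    q ^ suc k ∎

  blockCount-zero : blockCount zero ≡ q ^ suc k ∸ q
  blockCount-zero = begin
    blockCount zero
      ≡⟨ m+n∸n≡m (blockCount zero) q ⟨
    blockCount zero ℕ.+ q ∸ q
      ≡⟨ ≡.cong (λ s → blockCount zero ℕ.+ s ∸ q) constantBlocks ⟨
    blockCount zero ℕ.+ sum (λ i → blockCount (suc i)) ∸ q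
      ≡⟨ ≡.cong (_∸ q) sum-blockCount ⟩
    q ^ suc k ∸ q ∎
    where
    constantBlocks : sum (λ i → blockCount (suc i)) ≡ q
    constantBlocks =
      ≡.trans (cong (isSummation-sum {q}) blockCount-suc) (≡.trans (sum-const q 1) (ℕ.*-identityʳ q))

  blockCount≡blockWeight : ∀ a → blockCount a ≡ blockWeight a
  blockCount≡blockWeight zero    = blockCount-zero
  blockCount≡blockWeight (suc i) = blockCount-suc i

  sumBlocks-∘-blockColour : ∀ h → sumBlocks (λ c → h (blockColour c)) ≡ sumBlockColours h
  sumBlocks-∘-blockColour h = ≡.trans (summation-fibres isSummation-sumBlocks blockColour h)
    (cong (isSummation-sum {suc q}) (λ a → ≡.cong (ℕ._* h a) (blockCount≡blockWeight a)))

SameColour : ∀ {q} → Fin (suc q) → Fin (suc q) → Set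
SameColour x y = ∃ λ a → x ≡ suc a × y ≡ suc a

admissible : ∀ {q} → Fin (suc q) → Fin (suc q) → ℕ
admissible zero    _       = 1
admissible (suc _) zero    = 1
admissible (suc i) (suc j) with i ≟ j
... | yes _ = 0
... | no  _ = 1

admissible≡ind¬ : ∀ {q} (x y : Fin (suc q)) {P : Set} (P? : Dec P) →
                  (P → SameColour x y) → (SameColour x y → P) → admissible x y ≡ ind (¬? P?)
admissible≡ind¬ zero    y       P? to _ = 1≡ind¬? P? (λ p → 0≢1+n (proj₁ (proj₂ (to p))))
admissible≡ind¬ (suc i) zero    P? to _ = 1≡ind¬? P? (λ p → 0≢1+n (proj₂ (proj₂ (to p))))
admissible≡ind¬ (suc i) (suc j) P? to from with i ≟ j
... | yes i≡j = 0≡ind¬? P? (from (i , ≡.refl , ≡.cong suc (≡.sym i≡j)))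
... | no  i≢j = 1≡ind¬? P? (λ p → i≢j (sameIndex (proj₂ (to p))))
  where
  sameIndex : ∀ {a} → suc i ≡ suc a × suc j ≡ suc a → i ≡ j
  sameIndex (eᵢ , eⱼ) = ≡.trans (suc-injective eᵢ) (≡.sym (suc-injective eⱼ))

module Blowup (q k : ℕ) (G : Graph) where
  open Summation ℕ-semiring
  open Products ℕ-semiring using (prodList-cong)
  open BlockColours q k
  open ≡.≡-Reasoning

  block : Fin (n G) → List (Fin (n G ℕ.* suc k))
  block u = List.map (combine u) (List.allFin (suc k))

  All-block⇒ : ∀ (C : Fin (n G) → Block) u {a} →
               All (λ x → concat C x ≡ a) (block u) → ∀ j → C u j ≡ a
  All-block⇒ C u all j =
    ≡.trans (≡.sym (concat-combine C u j)) (AllP.tabulate⁻ {f = λ i → i} (AllP.map⁻ all) j)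

  All-block⇐ : ∀ (C : Fin (n G) → Block) u {a} →
               (∀ j → C u j ≡ a) → All (λ x → concat C x ≡ a) (block u)
  All-block⇐ C u constant =
    AllP.map⁺ (AllP.tabulate⁺ {f = λ i → i} (λ j → ≡.trans (concat-combine C u j) (constant j)))

  module _ (C : Fin (n G) → Block) (u v : Fin (n G)) where

    monochromatic⇒SameColour : Monochromatic (concat C) (block u List.++ block v) →
                               SameColour (blockColour (C u)) (blockColour (C v))
    monochromatic⇒SameColour (a , all) =
      a , constant⇒blockColour≡suc (C u) (All-block⇒ C u (AllP.++⁻ˡ (block u) all))
        , constant⇒blockColour≡suc (C v) (All-block⇒ C v (AllP.++⁻ʳ (block u) all))

    SameColour⇒monochromatic : SameColour (blockColour (C u)) (blockColour (C v)) →
                               Monochromatic (concat C) (block u List.++ block v)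
    SameColour⇒monochromatic (a , eᵤ , eᵥ) =
      a , AllP.++⁺ (All-block⇐ C u (blockColour≡suc⇒constant (C u) eᵤ))
                   (All-block⇐ C v (blockColour≡suc⇒constant (C v) eᵥ))

  properness : (Fin (n G ℕ.* suc k) → Fin q) → ℕ
  properness c = ind (proper? c (hedges (HG (suc k) G)))

  properness-extensional : Extensional properness
  properness-extensional {c} {c'} c≗c' = ind-cong (proper? c _) (proper? c' _)
    (All.map (λ ¬mono mono → ¬mono (recolour c≗c' mono)))
    (All.map (λ ¬mono mono → ¬mono (recolour (≡.sym ∘ c≗c') mono)))
    where
    recolour : ∀ {d d' : Fin (n G ℕ.* suc k) → Fin q} {e} →
               d ≗ d' → Monochromatic d' e → Monochromatic d e
    recolour d≗d' (a , all) = a , All.map (λ {x} eq → ≡.trans (d≗d' x) eq) all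

  admissibleProduct : (Fin (n G) → Fin (suc q)) → ℕ
  admissibleProduct σ = prodList ℕ-semiring (λ e → admissible (σ (proj₁ e)) (σ (proj₂ e))) (edges G)

  admissibleProduct-extensional : Extensional admissibleProduct
  admissibleProduct-extensional σ≗σ' =
    prodList-cong (edges G) (λ e → ≡.cong₂ admissible (σ≗σ' (proj₁ e)) (σ≗σ' (proj₂ e)))

  properness∘concat : ∀ C → properness (concat C) ≡ admissibleProduct (λ v → blockColour (C v))
  properness∘concat C = begin
    properness (concat C)
      ≡⟨ ind-All (λ e → ¬? (monochromatic? (concat C) e)) (hedges (HG (suc k) G)) ⟩
    prodList ℕ-semiring (λ e → ind (¬? (monochromatic? (concat C) e))) (hedges (HG (suc k) G))
      ≡⟨ foldr-map _ (λ e → block (proj₁ e) List.++ block (proj₂ e)) 1 (edges G) ⟩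
    prodList ℕ-semiring (λ (u , v) → ind (¬? (monochromatic? (concat C) (block u List.++ block v)))) (edges G)
      ≡⟨ prodList-cong (edges G) (λ (u , v) → ≡.sym (admissible≡ind¬ _ _
           (monochromatic? (concat C) (block u List.++ block v))
           (monochromatic⇒SameColour C u v) (SameColour⇒monochromatic C u v))) ⟩
    admissibleProduct (λ v → blockColour (C v)) ∎

  Zcol≡sumMapsWith-admissibleProduct : Zcol q (HG (suc k) G) ≡ sumMapsWith (n G) sumBlockColours admissibleProduct
  Zcol≡sumMapsWith-admissibleProduct = begin
    Zcol q (HG (suc k) G)
      ≡⟨ sumMaps≈sumMapsWith-sum (n G ℕ.* suc k) q properness ⟩
    sumMapsWith (n G ℕ.* suc k) sum properness
      ≡⟨ sumMapsWith-concat isSummation-sum (n G) (suc k) properness properness-extensional ⟩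
    sumMapsWith (n G) sumBlocks (λ C → properness (concat C))
      ≡⟨ sumMapsWith-cong isSummation-sumBlocks (n G) properness∘concat ⟩
    sumMapsWith (n G) sumBlocks (λ C → admissibleProduct (λ v → blockColour (C v)))
      ≡⟨ sumMapsWith-pushforward isSummation-sumBlocks blockColour sumBlocks-∘-blockColour
                                 (n G) admissibleProduct admissibleProduct-extensional ⟩
    sumMapsWith (n G) sumBlockColours admissibleProduct ∎

module VertexWeights {c ℓ} (R : CommutativeSemiring c ℓ) (q k : ℕ) (t : CommutativeSemiring.Carrier R)
                     (G : Graph) where
  open CommutativeSemiring R hiding (zero)
  open Summation R using (∏)
  open Products R
  open BlockColours q k using (blockWeight)
  open Blowup q k G using (admissibleProduct)
  open import Relation.Binary.Reasoning.Setoid setoid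

  vertexWeight : Fin (suc q) → Carrier
  vertexWeight zero    = t
  vertexWeight (suc _) = 1#

  B≈vertexWeight*admissible : ∀ x y →
                              B R q t x y ≈ (vertexWeight x * vertexWeight y) * fromℕ R (admissible x y)
  B≈vertexWeight*admissible zero    zero    = x≈x*fromℕ-1 (t * t)
  B≈vertexWeight*admissible zero    (suc j) = trans (sym (*-identityʳ t)) (x≈x*fromℕ-1 _)
  B≈vertexWeight*admissible (suc i) zero    = trans (sym (*-identityˡ t)) (x≈x*fromℕ-1 _)
  B≈vertexWeight*admissible (suc i) (suc j) with i ≟ j
  ... | yes _ = sym (zeroʳ _)
  ... | no  _ = trans (sym (*-identityˡ 1#)) (x≈x*fromℕ-1 _)

  module _ {Δ} (regular : Regular Δ G) (t^Δ : pow R t Δ ≈ fromℕ R (q ^ suc k ∸ q)) where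

    pow-vertexWeight : ∀ a → pow R (vertexWeight a) Δ ≈ fromℕ R (blockWeight a)
    pow-vertexWeight zero    = t^Δ
    pow-vertexWeight (suc _) = trans (pow-1# Δ) (sym fromℕ-1)

    prodList-B≈∏-blockWeight*admissibleProduct :
      ∀ σ → prodList R (λ e → B R q t (σ (proj₁ e)) (σ (proj₂ e))) (edges G) ≈
            ∏ (λ v → fromℕ R (blockWeight (σ v))) * fromℕ R (admissibleProduct σ)
    prodList-B≈∏-blockWeight*admissibleProduct σ = begin
      prodList R (λ e → B R q t (σ (proj₁ e)) (σ (proj₂ e))) (edges G)
        ≈⟨ prodList-cong (edges G) (λ e → B≈vertexWeight*admissible (σ (proj₁ e)) (σ (proj₂ e))) ⟩
      prodList R (λ e → (w (proj₁ e) * w (proj₂ e)) * fromℕ R (A e)) (edges G)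
        ≈⟨ prodList-distrib-* (edges G) _ _ ⟩
      prodList R (λ e → w (proj₁ e) * w (proj₂ e)) (edges G) * prodList R (λ e → fromℕ R (A e)) (edges G)
        ≈⟨ *-cong (prodList-endpoints≈∏-pow-degree (edges G) w) (sym (fromℕ-prodList A (edges G))) ⟩
      ∏ (λ v → pow R (w v) (degree G v)) * fromℕ R (admissibleProduct σ)
        ≈⟨ *-congʳ (∏-cong (λ v →
             trans (reflexive (≡.cong (pow R (w v)) (regular v))) (pow-vertexWeight (σ v)))) ⟩
      ∏ (λ v → fromℕ R (blockWeight (σ v))) * fromℕ R (admissibleProduct σ) ∎
      where
      w : Fin (n G) → Carrier
      w v = vertexWeight (σ v)
      A : Fin (n G) × Fin (n G) → ℕ
      A e = admissible (σ (proj₁ e)) (σ (proj₂ e))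

lemma3p1 : {c ℓ : Level} (R : CommutativeSemiring c ℓ) (q k Δ : ℕ) → 2 ≤ q → 1 ≤ k → 1 ≤ Δ →
    (t : CommutativeSemiring.Carrier R) →
    CommutativeSemiring._≈_ R (pow R t Δ) (fromℕ R (q ^ k ∸ q)) →
    (G : Graph) → Regular Δ G →
    CommutativeSemiring._≈_ R (ZB R q t G) (fromℕ R (Zcol q (HG k G)))
lemma3p1 R q (suc k) Δ _ _ _ t t^Δ G regular = begin
  ZB R q t G
    ≈⟨ sumMaps≈sumMapsWith-sum (n G) (suc q) _ ⟩
  sumMapsWith (n G) sum (λ σ → prodList R (λ e → B R q t (σ (proj₁ e)) (σ (proj₂ e))) (edges G))
    ≈⟨ sumMapsWith-cong isSummation-sum (n G) (prodList-B≈∏-blockWeight*admissibleProduct regular t^Δ) ⟩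
  sumMapsWith (n G) sum (λ σ → ∏ (λ v → w (σ v)) * fromℕ R (admissibleProduct σ))
    ≈⟨ sumMapsWith-reweight isSummation-sum (n G) w _ ⟩
  sumMapsWith (n G) (reweight w sum) (λ σ → fromℕ R (admissibleProduct σ))
    ≈⟨ sumMapsWith-natural (fromℕ R) (isSummation-reweight w isSummation-sum) (fromℕ-reweight blockWeight)
                           (n G) admissibleProduct ⟨
  fromℕ R (sumMapsWith (n G) sumBlockColours admissibleProduct)
    ≡⟨ ≡.cong (fromℕ R) Zcol≡sumMapsWith-admissibleProduct ⟨
  fromℕ R (Zcol q (HG (suc k) G)) ∎
  where
  open CommutativeSemiring R using (Carrier; _*_; setoid)
  open Summation R
  open Products R using (fromℕ-reweight)
  open BlockColours q k using (blockWeight; sumBlockColours)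
  open Blowup q k G using (admissibleProduct; Zcol≡sumMapsWith-admissibleProduct)
  open VertexWeights R q k t G using (prodList-B≈∏-blockWeight*admissibleProduct)
  open import Relation.Binary.Reasoning.Setoid setoid
  w : Fin (suc q) → Carrier
  w a = fromℕ R (blockWeight a)
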